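{- Let $\mathcal{M}=(X,\vec{\mathcal{C}},\mathcal{V})$ be a quasi-discrete closure model and $x_1,x_2\in X$. If $x_1$ and $x_2$ are CMC-bisimilar in $\mathcal{M}$, then for every ${\tt IMLC}$ formula $\Phi$, $\mathcal{M},x_1\models\Phi$ iff $\mathcal{M},x_2\models\Phi$.
   Context: Fix a set $\mathtt{AP}$ of atomic propositions. For a relation $R\subseteq X\times X$ let $\mathcal{C}_R(A)=A\cup\{x\in X:\exists a\in A,\ (a,x)\in R\}$. A quasi-discrete closure model is $\mathcal{M}=(X,\vec{\mathcal{C}},\mathcal{V})$ with $\vec{\mathcal{C}}=\mathcal{C}_R$ for a relation $R\subseteq X\times X$ and $\mathcal{V}:\mathtt{AP}\to\mathcal{P}(X)$; put $\overleftarrow{\mathcal{C}}=\mathcal{C}_{R^{ -1}}$ and write $\vec{\mathcal{C}}(x)$ for $\vec{\mathcal{C}}(\{x\})$, similarly for $\overleftarrow{\mathcal{C}}$. A symmetric relation $B\subseteq X\times X$ is a CMC-bisimulation if whenever $(x_1,x_2)\in B$: (1) for all $p\in\mathtt{AP}$, $x_1\in\mathcal{V}(p)$ iff $x_2\in\mathcal{V}(p)$; (2) for all $x_1'\in\vec{\mathcal{C}}(x_1)$ there is $x_2'\in\vec{\mathcal{C}}(x_2)$ with $(x_1',x_2')\in B$; (3) for all $x_1'\in\overleftarrow{\mathcal{C}}(x_1)$ there is $x_2'\in\overleftarrow{\mathcal{C}}(x_2)$ with $(x_1',x_2')\in B$. Points are CMC-bisimilar if some CMC-bisimulation contains the pair.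 ${\tt IMLC}$ formulas: $\Phi::=p\mid\neg\Phi\mid\bigwedge_{i\in I}\Phi_i\mid\vec{\mathcal{N}}\Phi\mid\overleftarrow{\mathcal{N}}\Phi$ ($I$ arbitrary index set), with $x\models p$ iff $x\in\mathcal{V}(p)$, usual Boolean clauses, $x\models\vec{\mathcal{N}}\Phi$ iff $x\in\vec{\mathcal{C}}(\{y:y\models\Phi\})$, $x\models\overleftarrow{\mathcal{N}}\Phi$ iff $x\in\overleftarrow{\mathcal{C}}(\{y:y\models\Phi\})$. -}

module Defs where

open import Data.Product using (Σ; _×_; _,_)
open import Data.Sum using (_⊎_)
open import Relation.Nullary using (¬_)
open import Relation.Binary.PropositionalEquality using (_≡_)
open import Function.Bundles using (_⇔_)

Pred : Set → Set₁
Pred X = X → Set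

C[_] : {X : Set} → (X → X → Set) → Pred X → Pred X
C[ R ] A x = A x ⊎ Σ _ (λ a → A a × R a x)

inv : {X : Set} → (X → X → Set) → (X → X → Set)
inv R x y = R y x

single : {X : Set} → X → Pred X
single x y = x ≡ y

-- Quasi-discrete closure model: carrier X, relation R (so →C = C_R), valuation V.
record QDCM (AP : Set) : Set₁ where
  field
    X : Set
    R : X → X → Set
    V : AP → Pred X

  Cf : Pred X → Pred X
  Cf = C[ R ]
  Cb : Pred X → Pred X
  Cb = C[ inv R ]

data Form (AP : Set) : Set₁ where
  atom : AP → Form AP
  ¬ᶠ   : Form AP → Form AP
  ⋀    : (I : Set) → (I → Form AP) → Form AP
  Nf   : Form AP → Form AP
  Nb   : Form AP → Form AP

module _ {AP : Set} (M : QDCM AP) where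
  open QDCM M

  infix 4 _⊨_
  _⊨_ : X → Form AP → Set
  x ⊨ atom p  = V p x
  x ⊨ ¬ᶠ Φ    = ¬ (x ⊨ Φ)
  x ⊨ ⋀ I Φs  = (i : I) → x ⊨ Φs i
  x ⊨ Nf Φ    = Cf (λ y → y ⊨ Φ) x
  x ⊨ Nb Φ    = Cb (λ y → y ⊨ Φ) x

  record IsCMCBisim (B : X → X → Set) : Set where
    field
      sym   : ∀ {x₁ x₂} → B x₁ x₂ → B x₂ x₁
      atoms : ∀ {x₁ x₂} → B x₁ x₂ → (p : AP) → (V p x₁ ⇔ V p x₂)
      fwd   : ∀ {x₁ x₂} → B x₁ x₂ → ∀ x₁' → Cf (single x₁) x₁' →
              Σ X (λ x₂' → Cf (single x₂) x₂' × B x₁' x₂')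
      bwd   : ∀ {x₁ x₂} → B x₁ x₂ → ∀ x₁' → Cb (single x₁) x₁' →
              Σ X (λ x₂' → Cb (single x₂) x₂' × B x₁' x₂')

  CMCBisimilar : X → X → Set₁
  CMCBisimilar x₁ x₂ = Σ (X → X → Set) (λ B → IsCMCBisim B × B x₁ x₂)

module Submission where

open import Defs
open import Function.Bundles using (_⇔_; mk⇔; Equivalence)
open import Data.Product using (Σ; _×_; _,_)
open import Data.Sum using (inj₁; inj₂)
open import Relation.Binary.PropositionalEquality using (refl)

-- The one point to notice is
-- that x ⊨ Nf Φ is witnessed by an R-*predecessor* of x, i.e. a point of
-- Cb {x}, so the Nf case is matched by clause (3) of the bisimulation and
-- the Nb case by clause (2).

module _ {AP : Set} (M : QDCM AP) where
  open QDCM M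

  -- The S-predecessors of x, together with x itself, are exactly C[ inv S ] {x};
  -- matching those along B is all that C[ S ] A x needs to move to y.
  C-transfer : (S : X → X → Set) (B : X → X → Set) {A A' : Pred X} →
    (∀ {a a'} → B a a' → A a → A' a') →
    ∀ {x y} → B x y →
    (∀ a → C[ inv S ] (single x) a →
       Σ X (λ a' → C[ inv S ] (single y) a' × B a a')) →
    C[ S ] A x → C[ S ] A' y
  C-transfer S B A→A' Bxy match (inj₁ Ax) = inj₁ (A→A' Bxy Ax)
  C-transfer S B A→A' {x} Bxy match (inj₂ (a , Aa , Sax))
    with match a (inj₂ (x , refl , Sax))
  ... | a' , inj₁ refl , Baa' = inj₁ (A→A' Baa' Aa)
  ... | a' , inj₂ (_ , refl , Sa'y) , Baa' = inj₂ (a' , A→A' Baa' Aa , Sa'y)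

  module _ {B : X → X → Set} (isB : IsCMCBisim M B) where
    open IsCMCBisim isB

    ⊨-transfer : ∀ {x y} → B x y → (Φ : Form AP) → _⊨_ M x Φ → _⊨_ M y Φ
    ⊨-transfer Bxy (atom p)  = Equivalence.to (atoms Bxy p)
    ⊨-transfer Bxy (¬ᶠ Φ)    = λ x⊭Φ y⊨Φ → x⊭Φ (⊨-transfer (sym Bxy) Φ y⊨Φ)
    ⊨-transfer Bxy (⋀ I Φs)  = λ x⊨Φs i → ⊨-transfer Bxy (Φs i) (x⊨Φs i)
    ⊨-transfer Bxy (Nf Φ)    =
      C-transfer R B (λ Baa' → ⊨-transfer Baa' Φ) Bxy (bwd Bxy)
    ⊨-transfer Bxy (Nb Φ)    =
      C-transfer (inv R) B (λ Baa' → ⊨-transfer Baa' Φ) Bxy (fwd Bxy)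

lemma4p11 : {AP : Set} (M : QDCM AP) (x₁ x₂ : QDCM.X M) →
    CMCBisimilar M x₁ x₂ →
    (Φ : Form AP) → (_⊨_ M x₁ Φ ⇔ _⊨_ M x₂ Φ)
lemma4p11 M x₁ x₂ (B , isB , Bx₁x₂) Φ =
  mk⇔ (⊨-transfer M isB Bx₁x₂ Φ)
      (⊨-transfer M isB (IsCMCBisim.sym isB Bx₁x₂) Φ)
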